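{- Any simple binary Boolean VCSP instance $\mathcal{C}'$ can be transformed into a trim binary Boolean VCSP instance $\mathcal{C}$ that is sign-equivalent to $\mathcal{C}'$.
   Context: Variables are indexed by $[n]$, each with domain $\{0,1\}$; points are $x\in\{0,1\}^n$; $x[i\mapsto b]$ is $x$ with coordinate $i$ set to $b$, and $\bar b=1-b$. A (valued) constraint with scope $S\subseteq[n]$ is a function $C_S:\{0,1\}^S\to\mathbb{Z}$. A binary Boolean VCSP instance is a finite set of constraints with scopes of size at most $2$, at most one per scope; it implements $f(x)=\sum_{C_S\in\mathcal{C}}C_S(x[S])$. Its fitness graph $G_\mathcal{C}$ has vertex set $\{0,1\}^n$ and a directed edge $(x,y)$ iff $x,y$ differ in exactly one coordinate and $f(y)>f(x)$. Two instances are sign-equivalent if they have the same fitness graph. The constraint graph has vertex set $[n]$ and edge set $E(\mathcal{C})$ of those $\{i,j\}$ for which $\mathcal{C}$ has a binary constraint with scope $\{i,j\}$ that is not identically zero. An instance is simple if every unary constraint satisfies $C_i(0)=0,C_i(1)=c_i$ and every binary constraint satisfies $C_{ij}(0,0)=C_{ij}(0,1)=C_{ij}(1,0)=0$, $C_{ij}(1,1)=c_{ij}$ (a constant constraint is allowed). In a fitness graph $G$ on $\{0,1\}^n$, $i$ sign-depends on $j$ if there is $x\in\{0,1\}^n$ with $(x,x[i\mapsto\bar x_i])\in E(G)$ but $(x[j\mapsto \bar x_j],x[i\mapsto\bar x_i,j\mapsto\bar x_j])\notin E(G)$; $i$ and $j$ sign-interact if $i$ sign-depends on $j$ or $j$ sign-depends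 on $i$. A simple binary Boolean instance $\mathcal{C}$ is trim if for every $\{i,j\}\in E(\mathcal{C})$, $i$ and $j$ sign-interact in $G_\mathcal{C}$. -}

module Defs where

open import Data.Nat using (ℕ)
open import Data.Bool using (Bool; true; false; not; if_then_else_; _∧_)
open import Data.Fin using (Fin; toℕ; _≟_)
open import Data.List using (List; foldr; allFin)
open import Data.Integer using (ℤ; 0ℤ; _+_; _>_)
open import Data.Product using (Σ; ∃; _×_; _,_)
open import Data.Sum using (_⊎_)
open import Relation.Nullary using (¬_; does)
open import Relation.Binary.PropositionalEquality using (_≡_; _≢_)
import Data.Nat as ℕ

-- Points x ∈ {0,1}^n, with 0 = false, 1 = true.
Point : ℕ → Set
Point n = Fin n → Bool

_[_↦_] : ∀ {n} → Point n → Fin n → Bool → Point n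
(x [ i ↦ b ]) j = if does (j ≟ i) then b else x j

flip : ∀ {n} → Fin n → Point n → Point n
flip i x = x [ i ↦ not (x i) ]

sumℤ : List ℤ → ℤ
sumℤ = foldr _+_ 0ℤ

-- A simple binary Boolean VCSP instance on n variables.
--   const      : the (optional) constant (nullary) constraint;
--   unary i    : c_i, i.e. C_i(0) = 0, C_i(1) = c_i;
--   binary i j : for toℕ i < toℕ j, c_ij, i.e. C_ij(1,1) = c_ij and 0 otherwise.
-- Entries binary i j with toℕ i ≥ toℕ j are ignored (one constraint per scope).
-- An absent constraint is represented by coefficient 0 (it implements the same f
-- and contributes no edge to the constraint graph).
record SimpleInstance (n : ℕ) : Set where
  field
    const  : ℤ
    unary  : Fin n → ℤ
    binary : Fin n → Fin n → ℤ
open SimpleInstance public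

eval : ∀ {n} → SimpleInstance n → Point n → ℤ
eval {n} C x =
  const C
  + sumℤ (Data.List.map (λ i → if x i then unary C i else 0ℤ) (allFin n))
  + sumℤ (Data.List.map (λ i → sumℤ (Data.List.map
        (λ j → if does (toℕ i ℕ.<? toℕ j) ∧ x i ∧ x j then binary C i j else 0ℤ)
        (allFin n))) (allFin n))

DifferInOne : ∀ {n} → Point n → Point n → Set
DifferInOne {n} x y = Σ (Fin n) λ i → (x i ≢ y i) × (∀ j → j ≢ i → x j ≡ y j)

FitEdge : ∀ {n} → SimpleInstance n → Point n → Point n → Set
FitEdge C x y = DifferInOne x y × (eval C y > eval C x)

SignEquivalent : ∀ {n} → SimpleInstance n → SimpleInstance n → Set
SignEquivalent {n} C C' =
  (x y : Point n) → (FitEdge C x y → FitEdge C' x y) × (FitEdge C' x y → FitEdge C x y)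

SignDepends : ∀ {n} → (Point n → Point n → Set) → Fin n → Fin n → Set
SignDepends {n} G i j =
  Σ (Point n) λ x → G x (flip i x) × ¬ G (flip j x) (flip i (flip j x))

SignInteract : ∀ {n} → (Point n → Point n → Set) → Fin n → Fin n → Set
SignInteract G i j = SignDepends G i j ⊎ SignDepends G j i

InConstraintGraph : ∀ {n} → SimpleInstance n → Fin n → Fin n → Set
InConstraintGraph C i j = (toℕ i ℕ.< toℕ j) × (binary C i j ≢ 0ℤ)

Trim : ∀ {n} → SimpleInstance n → Set
Trim {n} C = (i j : Fin n) → InConstraintGraph C i j → SignInteract (FitEdge C) i j

-- Treat the pairs {a, b} one at a time, erasing c_ab when neither of a, b sign-depends on the
-- other. This keeps the fitness graph. Flipping a variable other than a, b leaves x_a x_b, hence the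
-- gain, unchanged. For flipping a, the erased instance has a gain independent of x_b, the original
-- one a gain whose sign is independent of x_b, and the two gains agree where x_b = 0; symmetrically
-- for b. Erasing only removes edges of the constraint graph, and sign-interaction depends only on
-- the fitness graph, so the pairs treated earlier stay trim.
module Submission where

open import Defs
open import Algebra.Properties.CommutativeSemigroup using (interchange)
open import Data.Bool using (Bool; true; false; not; if_then_else_; _∧_)
open import Data.Bool.Properties using (∧-zeroʳ; not-involutive; not-¬; ¬-not; if-eta; if-cong; if-cong-then; if-cong₂)
open import Data.Empty using (⊥-elim)
open import Data.Fin using (Fin; toℕ; _≟_)
open import Data.Integer using (ℤ; 0ℤ; _+_; _<_; -_; _<?_)
open import Data.Integer.Properties using (+-comm; +-monoʳ-<; +-monoˡ-<; +-commutativeSemigroup)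
open import Data.Integer.Tactic.RingSolver using (solve-∀)
open import Data.List using (List; []; _∷_; map; allFin; cartesianProduct)
open import Data.List.Membership.Propositional.Properties using (∈-cartesianProduct⁺; ∈-allFin)
open import Data.List.Relation.Unary.All as All using (All; []; _∷_)
open import Data.Nat using (ℕ)
import Data.Nat as ℕ
import Data.Nat.Properties as ℕ
open import Data.Product using (Σ; Σ-syntax; _×_; _,_; proj₁; proj₂; uncurry)
open import Data.Vec.Functional using (head; tail) renaming (_∷_ to _∷ᵛ_)
open import Data.Vec.Functional.Properties using (∷-cong)
open import Data.Sum using (_⊎_; inj₁; inj₂; swap)
open import Function using (id; _∘_; _⇔_; mk⇔; Equivalence)
import Function.Properties.Equivalence as ⇔
open import Relation.Nullary using (¬_; Dec; yes; no; does; _→-dec_)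
open import Relation.Nullary.Decidable using (dec-true; dec-false)
open import Relation.Binary.PropositionalEquality

module _ {n : ℕ} where

  AgreeOff : Fin n → Point n → Point n → Set
  AgreeOff i x y = ∀ k → k ≢ i → x k ≡ y k

  agreeOff-sym : ∀ {i} {x y : Point n} → AgreeOff i x y → AgreeOff i y x
  agreeOff-sym x≈y k k≢i = sym (x≈y k k≢i)

  flip-self : ∀ i (x : Point n) → flip i x i ≡ not (x i)
  flip-self i x = if-cong (dec-true (i ≟ i) refl)

  flip-other : ∀ {i k} (x : Point n) → k ≢ i → flip i x k ≡ x k
  flip-other {i} {k} x k≢i = if-cong (dec-false (k ≟ i) k≢i)

  flip-agreeOff : ∀ i (x : Point n) → AgreeOff i (flip i x) x
  flip-agreeOff i x k = flip-other x

  flip-preserves-agreeOff : ∀ i {j} {x y : Point n} → AgreeOff j x y → AgreeOff j (flip i x) (flip i y)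
  flip-preserves-agreeOff i x≈y k k≢j with k ≟ i
  ... | yes refl = cong not (x≈y k k≢j)
  ... | no _ = x≈y k k≢j

  flip-cong : ∀ i {x y : Point n} → x ≗ y → flip i x ≗ flip i y
  flip-cong i x≗y k = if-cong₂ (does (k ≟ i)) (cong not (x≗y i)) (x≗y k)

  flip-involutive : ∀ i (x : Point n) → flip i (flip i x) ≗ x
  flip-involutive i x k with k ≟ i
  ... | yes refl = trans (cong not (flip-self k x)) (not-involutive (x k))
  ... | no _ = refl

  flip-differInOne : ∀ i (x : Point n) → DifferInOne x (flip i x)
  flip-differInOne i x = i , (λ e → not-¬ refl (trans e (flip-self i x))) , (λ k k≢i → sym (flip-other x k≢i))

  differInOne⇒flip : ∀ {x y : Point n} → DifferInOne x y → Σ[ i ∈ Fin n ] y ≗ flip i x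
  differInOne⇒flip {x} {y} (i , xᵢ≢yᵢ , same) = i , agree
    where
    agree : y ≗ flip i x
    agree k with k ≟ i
    ... | yes refl = ¬-not (≢-sym xᵢ≢yᵢ)
    ... | no k≢i = sym (same k k≢i)

sumℤ-cong : ∀ {A : Set} (xs : List A) {f g : A → ℤ} → (∀ k → f k ≡ g k) →
  sumℤ (map f xs) ≡ sumℤ (map g xs)
sumℤ-cong [] f≗g = refl
sumℤ-cong (k ∷ xs) f≗g = cong₂ _+_ (f≗g k) (sumℤ-cong xs f≗g)

+-interchange : ∀ a b c d → (a + b) + (c + d) ≡ (a + c) + (b + d)
+-interchange = interchange +-commutativeSemigroup

sumℤ-interchange : ∀ {A : Set} (xs : List A) {f₁ f₂ f₃ f₄ : A → ℤ} →
  (∀ k → f₁ k + f₂ k ≡ f₃ k + f₄ k) →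
  sumℤ (map f₁ xs) + sumℤ (map f₂ xs) ≡ sumℤ (map f₃ xs) + sumℤ (map f₄ xs)
sumℤ-interchange [] eq = refl
sumℤ-interchange (k ∷ xs) {f₁} {f₂} {f₃} {f₄} eq = begin
  (f₁ k + _) + (f₂ k + _) ≡⟨ +-interchange (f₁ k) _ (f₂ k) _ ⟩
  (f₁ k + f₂ k) + _       ≡⟨ cong₂ _+_ (eq k) (sumℤ-interchange xs eq) ⟩
  (f₃ k + f₄ k) + _       ≡⟨ +-interchange (f₃ k) _ (f₄ k) _ ⟨
  (f₃ k + _) + (f₄ k + _) ∎
  where open ≡-Reasoning

cross-sum-<⇔ : ∀ p q p′ q′ → p + q′ ≡ p′ + q → q < p ⇔ q′ < p′
cross-sum-<⇔ p q p′ q′ eq = mk⇔ (transfer eq) (transfer (sym eq))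
  where
  cancelʳ : ∀ {u v} w → u + w < v + w → u < v
  cancelʳ {u} {v} w lt = subst₂ _<_ (cancel u w) (cancel v w) (+-monoˡ-< (- w) lt)
    where
    cancel : ∀ z w → z + w + - w ≡ z
    cancel = solve-∀
  transfer : ∀ {p q p′ q′} → p + q′ ≡ p′ + q → q < p → q′ < p′
  transfer {p} {q} {p′} {q′} eq q<p =
    cancelʳ q (subst (q′ + q <_) (trans (+-comm q′ p) eq) (+-monoʳ-< q′ q<p))

module _ {n : ℕ} where

  unaryTerm : SimpleInstance n → Point n → Fin n → ℤ
  unaryTerm D x k = if x k then unary D k else 0ℤ

  binaryTerm : SimpleInstance n → Point n → Fin n → Fin n → ℤ
  binaryTerm D x k l = if does (toℕ k ℕ.<? toℕ l) ∧ x k ∧ x l then binary D k l else 0ℤ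

  eval-interchange : ∀ {D₁ D₂ D₃ D₄ : SimpleInstance n} {x₁ x₂ x₃ x₄ : Point n} →
    const D₁ + const D₂ ≡ const D₃ + const D₄ →
    (∀ k → unaryTerm D₁ x₁ k + unaryTerm D₂ x₂ k ≡ unaryTerm D₃ x₃ k + unaryTerm D₄ x₄ k) →
    (∀ k l → binaryTerm D₁ x₁ k l + binaryTerm D₂ x₂ k l
           ≡ binaryTerm D₃ x₃ k l + binaryTerm D₄ x₄ k l) →
    eval D₁ x₁ + eval D₂ x₂ ≡ eval D₃ x₃ + eval D₄ x₄
  eval-interchange {D₁} {D₂} {D₃} {D₄} {x₁} {x₂} {x₃} {x₄} consts unaries binaries =
    trans (regroup D₁ x₁ D₂ x₂)
      (trans (cong₂ _+_ (cong₂ _+_ consts (sumℤ-interchange (allFin n) unaries))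
                        (sumℤ-interchange (allFin n) λ k → sumℤ-interchange (allFin n) (binaries k)))
             (sym (regroup D₃ x₃ D₄ x₄)))
    where
    unarySum : SimpleInstance n → Point n → ℤ
    unarySum D x = sumℤ (map (unaryTerm D x) (allFin n))
    binarySum : SimpleInstance n → Point n → ℤ
    binarySum D x = sumℤ (map (λ k → sumℤ (map (binaryTerm D x k) (allFin n))) (allFin n))
    regroup : ∀ D x D′ x′ → eval D x + eval D′ x′ ≡
      ((const D + const D′) + (unarySum D x + unarySum D′ x′)) + (binarySum D x + binarySum D′ x′)
    regroup D x D′ x′ =
      trans (+-interchange (const D + unarySum D x) (binarySum D x) (const D′ + unarySum D′ x′) _)
            (cong (_+ (binarySum D x + binarySum D′ x′))
                  (+-interchange (const D) (unarySum D x) (const D′) (unarySum D′ x′)))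

  eval-cong : ∀ D {x y : Point n} → x ≗ y → eval D x ≡ eval D y
  eval-cong D x≗y = cong₂ (λ u b → const D + u + b)
    (sumℤ-cong (allFin n) λ k → if-cong (x≗y k))
    (sumℤ-cong (allFin n) λ k → sumℤ-cong (allFin n) λ l →
      if-cong (cong₂ (λ u v → does (toℕ k ℕ.<? toℕ l) ∧ u ∧ v) (x≗y k) (x≗y l)))

  Improves : SimpleInstance n → Fin n → Point n → Set
  Improves D i x = eval D x < eval D (flip i x)

  improves-cong : ∀ D i {x y : Point n} → x ≗ y → Improves D i x → Improves D i y
  improves-cong D i x≗y = subst₂ _<_ (eval-cong D x≗y) (eval-cong D (flip-cong i x≗y))

  fitEdge-transfer : ∀ {A B : SimpleInstance n} → (∀ i x → Improves A i x → Improves B i x) →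
    ∀ {x y} → FitEdge A x y → FitEdge B x y
  fitEdge-transfer {A} {B} improves {x} {y} (x~y , gain) with differInOne⇒flip x~y
  ... | i , y≗flipᵢx = x~y , subst (eval B x <_) (eval-cong B (sym ∘ y≗flipᵢx))
                                 (improves i x (subst (eval A x <_) (eval-cong A y≗flipᵢx) gain))

  signEquivalent-from-improves : ∀ (A B : SimpleInstance n) → (∀ i x → Improves A i x ⇔ Improves B i x) →
    SignEquivalent A B
  signEquivalent-from-improves A B improves x y =
    fitEdge-transfer {A} {B} (λ i x → Equivalence.to (improves i x)) ,
    fitEdge-transfer {B} {A} (λ i x → Equivalence.from (improves i x))

  improves-flip-invariant : ∀ D i j → (∀ x → Improves D i x → Improves D i (flip j x)) →
    ∀ x → Improves D i x ⇔ Improves D i (flip j x)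
  improves-flip-invariant D i j monotone x =
    mk⇔ (monotone x) (λ gain → improves-cong D i (flip-involutive j x) (monotone (flip j x) gain))

  ⇔-from-false-slice : ∀ {P Q : Point n → Set} j →
    (∀ x → P x ⇔ P (flip j x)) → (∀ x → Q x ⇔ Q (flip j x)) →
    (∀ x → x j ≡ false → P x ⇔ Q x) → ∀ x → P x ⇔ Q x
  ⇔-from-false-slice j P-invariant Q-invariant slice x with x j in xⱼ
  ... | false = slice x xⱼ
  ... | true = ⇔.trans (P-invariant x)
                 (⇔.trans (slice (flip j x) (trans (flip-self j x) (cong not xⱼ))) (⇔.sym (Q-invariant x)))

  Ignores : Fin n → (Point n → ℤ) → Set
  Ignores i g = ∀ {x y} → AgreeOff i x y → g x ≡ g y

  vanishing-ignores : ∀ {i} (g : Point n → ℤ) → (∀ x → g x ≡ 0ℤ) → Ignores i g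
  vanishing-ignores g g≡0 {x} {y} _ = trans (g≡0 x) (sym (g≡0 y))

  NoInteraction : SimpleInstance n → Fin n → Fin n → Set
  NoInteraction D i j = ∀ x → eval D (flip i (flip j x)) + eval D x ≡ eval D (flip i x) + eval D (flip j x)

  Separates : SimpleInstance n → Fin n → Fin n → Set
  Separates D i j =
    (∀ k → Ignores i (λ x → unaryTerm D x k) ⊎ Ignores j (λ x → unaryTerm D x k)) ×
    (∀ k l → Ignores i (λ x → binaryTerm D x k l) ⊎ Ignores j (λ x → binaryTerm D x k l))

  separates-sym : ∀ D {i j} → Separates D i j → Separates D j i
  separates-sym D (unaries , binaries) = (swap ∘ unaries) , (λ k l → swap (binaries k l))

  square-if-ignores : ∀ {i j} (g : Point n → ℤ) → Ignores i g ⊎ Ignores j g →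
    ∀ x → g (flip i (flip j x)) + g x ≡ g (flip i x) + g (flip j x)
  square-if-ignores {i} {j} g (inj₁ ignoresᵢ) x =
    trans (cong₂ _+_ (ignoresᵢ (flip-agreeOff i (flip j x))) (ignoresᵢ (agreeOff-sym (flip-agreeOff i x))))
          (+-comm (g (flip j x)) (g (flip i x)))
  square-if-ignores {i} {j} g (inj₂ ignoresⱼ) x =
    cong₂ _+_ (ignoresⱼ (flip-preserves-agreeOff i (flip-agreeOff j x)))
              (ignoresⱼ (agreeOff-sym (flip-agreeOff j x)))

  separates⇒noInteraction : ∀ D {i j} → Separates D i j → NoInteraction D i j
  separates⇒noInteraction D {i} {j} (unaries , binaries) x =
    eval-interchange {D} {D} {D} {D} {flip i (flip j x)} {x} {flip i x} {flip j x} refl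
      (λ k → square-if-ignores (λ y → unaryTerm D y k) (unaries k) x)
      (λ k l → square-if-ignores (λ y → binaryTerm D y k l) (binaries k l) x)

  noInteraction⇒improves-invariant : ∀ D {i j} → NoInteraction D i j →
    ∀ x → Improves D i x ⇔ Improves D i (flip j x)
  noInteraction⇒improves-invariant D {i} {j} square x =
    ⇔.sym (cross-sum-<⇔ (eval D (flip i (flip j x))) (eval D (flip j x)) (eval D (flip i x)) (eval D x) (square x))

  unaryTerm-ignores : ∀ D {i k} → k ≢ i → Ignores i (λ x → unaryTerm D x k)
  unaryTerm-ignores D k≢i x≈y = if-cong (x≈y _ k≢i)

  binaryTerm-ignores : ∀ D {i k l} → k ≢ i → l ≢ i → Ignores i (λ x → binaryTerm D x k l)
  binaryTerm-ignores D {k = k} {l} k≢i l≢i x≈y =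
    if-cong (cong₂ (λ u v → does (toℕ k ℕ.<? toℕ l) ∧ u ∧ v) (x≈y k k≢i) (x≈y l l≢i))

  binaryTerm-coefficient : ∀ {D D′ k l} → binary D k l ≡ binary D′ k l →
    ∀ x → binaryTerm D x k l ≡ binaryTerm D′ x k l
  binaryTerm-coefficient {k = k} {l} same x = if-cong-then (does (toℕ k ℕ.<? toℕ l) ∧ x k ∧ x l) same

  binaryTerm-zero : ∀ D {k l} → binary D k l ≡ 0ℤ → ∀ x → binaryTerm D x k l ≡ 0ℤ
  binaryTerm-zero D {k} {l} c≡0 x = trans (if-cong-then guard c≡0) (if-eta guard)
    where
    guard : Bool
    guard = does (toℕ k ℕ.<? toℕ l) ∧ x k ∧ x l

  binaryTerm-unordered : ∀ D {k l} → ¬ toℕ k ℕ.< toℕ l → ∀ x → binaryTerm D x k l ≡ 0ℤ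
  binaryTerm-unordered D {k} {l} k≮l x = if-cong (cong (_∧ (x k ∧ x l)) (dec-false (toℕ k ℕ.<? toℕ l) k≮l))

  zero-coefficient-separates : ∀ D {a b} → toℕ a ℕ.< toℕ b → binary D a b ≡ 0ℤ → Separates D a b
  zero-coefficient-separates D {a} {b} a<b c≡0 = unaries , binaries
    where
    a≢b : a ≢ b
    a≢b a≡b = ℕ.<-irrefl (cong toℕ a≡b) a<b
    unaries : ∀ k → Ignores a (λ x → unaryTerm D x k) ⊎ Ignores b (λ x → unaryTerm D x k)
    unaries k with k ≟ a
    ... | yes refl = inj₂ (unaryTerm-ignores D a≢b)
    ... | no k≢a = inj₁ (unaryTerm-ignores D k≢a)
    binaries : ∀ k l → Ignores a (λ x → binaryTerm D x k l) ⊎ Ignores b (λ x → binaryTerm D x k l)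
    binaries k l with k ≟ a | l ≟ a | k ≟ b | l ≟ b
    ... | no k≢a | no l≢a | _ | _ = inj₁ (binaryTerm-ignores D k≢a l≢a)
    ... | _ | _ | no k≢b | no l≢b = inj₂ (binaryTerm-ignores D k≢b l≢b)
    ... | yes refl | _ | yes refl | _ = ⊥-elim (a≢b refl)
    ... | _ | yes refl | _ | yes refl = ⊥-elim (a≢b refl)
    ... | yes refl | _ | _ | yes refl = inj₁ (vanishing-ignores _ (binaryTerm-zero D c≡0))
    ... | _ | yes refl | yes refl | _ = inj₁ (vanishing-ignores _ (binaryTerm-unordered D (ℕ.<-asym a<b)))

  erase : SimpleInstance n → Fin n → Fin n → SimpleInstance n
  erase C a b = record C { binary = λ k l → if does (k ≟ a) ∧ does (l ≟ b) then 0ℤ else binary C k l }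

  erase-erases : ∀ C a b → binary (erase C a b) a b ≡ 0ℤ
  erase-erases C a b = if-cong (cong₂ _∧_ (dec-true (a ≟ a) refl) (dec-true (b ≟ b) refl))

  erase-binary : ∀ C a b k l → (k ≡ a × l ≡ b) ⊎ binary (erase C a b) k l ≡ binary C k l
  erase-binary C a b k l with k ≟ a | l ≟ b
  ... | yes k≡a | yes l≡b = inj₁ (k≡a , l≡b)
  ... | yes _ | no _ = inj₂ refl
  ... | no _ | _ = inj₂ refl

  erase-interchange : ∀ C a b i x → (flip i x a ∧ flip i x b) ≡ (x a ∧ x b) →
    eval C (flip i x) + eval (erase C a b) x ≡ eval (erase C a b) (flip i x) + eval C x
  erase-interchange C a b i x xₐxᵦ-fixed = eval-interchange {C} {C₀} {C₀} {C} refl (λ k → refl) binaries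
    where
    C₀ = erase C a b
    binaries : ∀ k l → binaryTerm C (flip i x) k l + binaryTerm C₀ x k l
                     ≡ binaryTerm C₀ (flip i x) k l + binaryTerm C x k l
    binaries k l with erase-binary C a b k l
    ... | inj₁ (refl , refl) = begin
      binaryTerm C (flip i x) a b + binaryTerm C₀ x a b
        ≡⟨ cong₂ _+_ (if-cong (cong (does (toℕ a ℕ.<? toℕ b) ∧_) xₐxᵦ-fixed))
                     (binaryTerm-zero C₀ (erase-erases C a b) x) ⟩
      binaryTerm C x a b + 0ℤ
        ≡⟨ +-comm (binaryTerm C x a b) 0ℤ ⟩
      0ℤ + binaryTerm C x a b
        ≡⟨ cong (_+ binaryTerm C x a b) (binaryTerm-zero C₀ (erase-erases C a b) (flip i x)) ⟨
      binaryTerm C₀ (flip i x) a b + binaryTerm C x a b ∎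
      where open ≡-Reasoning
    ... | inj₂ same =
      cong₂ _+_ (sym (binaryTerm-coefficient {C₀} {C} same (flip i x))) (binaryTerm-coefficient {C₀} {C} same x)

  erase-improves⇔ : ∀ C a b i x → (flip i x a ∧ flip i x b) ≡ (x a ∧ x b) →
    Improves (erase C a b) i x ⇔ Improves C i x
  erase-improves⇔ C a b i x xₐxᵦ-fixed = ⇔.sym (cross-sum-<⇔ (eval C (flip i x)) (eval C x)
    (eval (erase C a b) (flip i x)) (eval (erase C a b) x) (erase-interchange C a b i x xₐxᵦ-fixed))

  erase-signEquivalent : ∀ C {a b} → toℕ a ℕ.< toℕ b →
    (∀ x → Improves C a x → Improves C a (flip b x)) →
    (∀ x → Improves C b x → Improves C b (flip a x)) →
    SignEquivalent (erase C a b) C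
  erase-signEquivalent C {a} {b} a<b a-monotone b-monotone = signEquivalent-from-improves (erase C a b) C improves⇔
    where
    C₀ = erase C a b
    a≢b : a ≢ b
    a≢b a≡b = ℕ.<-irrefl (cong toℕ a≡b) a<b
    separated : Separates C₀ a b
    separated = zero-coefficient-separates C₀ a<b (erase-erases C a b)
    flipₐ-fixed : ∀ y → y b ≡ false → (flip a y a ∧ flip a y b) ≡ (y a ∧ y b)
    flipₐ-fixed y y-b = trans (cong (flip a y a ∧_) (trans (flip-other y (≢-sym a≢b)) y-b))
                              (trans (∧-zeroʳ _) (sym (trans (cong (y a ∧_) y-b) (∧-zeroʳ _))))
    flipᵦ-fixed : ∀ y → y a ≡ false → (flip b y a ∧ flip b y b) ≡ (y a ∧ y b)
    flipᵦ-fixed y y-a = trans (cong (_∧ flip b y b) (trans (flip-other y a≢b) y-a)) (cong (_∧ y b) (sym y-a))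
    improves⇔ : ∀ i x → Improves C₀ i x ⇔ Improves C i x
    improves⇔ i x with i ≟ a | i ≟ b
    ... | yes refl | _ =
      ⇔-from-false-slice b (noInteraction⇒improves-invariant C₀ (separates⇒noInteraction C₀ separated))
        (improves-flip-invariant C a b a-monotone) (λ y y-b → erase-improves⇔ C a b a y (flipₐ-fixed y y-b)) x
    ... | no _ | yes refl =
      ⇔-from-false-slice a
        (noInteraction⇒improves-invariant C₀ (separates⇒noInteraction C₀ (separates-sym C₀ separated)))
        (improves-flip-invariant C b a b-monotone) (λ y y-a → erase-improves⇔ C a b b y (flipᵦ-fixed y y-a)) x
    ... | no i≢a | no i≢b =
      erase-improves⇔ C a b i x (cong₂ _∧_ (flip-other x (≢-sym i≢a)) (flip-other x (≢-sym i≢b)))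

all-or-counterexample : ∀ n (P : Point n → Set) → (∀ {x y} → x ≗ y → P x → P y) → (∀ x → Dec (P x)) →
  (∀ x → P x) ⊎ Σ[ x ∈ Point n ] ¬ P x
all-or-counterexample ℕ.zero P resp P? with P? (λ ())
... | yes p = inj₁ (λ x → resp (λ ()) p)
... | no ¬p = inj₂ ((λ ()) , ¬p)
all-or-counterexample (ℕ.suc n) P resp P?
  with all-or-counterexample n (P ∘ (false ∷ᵛ_)) (λ x≗y → resp (∷-cong refl x≗y)) (P? ∘ (false ∷ᵛ_))
     | all-or-counterexample n (P ∘ (true ∷ᵛ_)) (λ x≗y → resp (∷-cong refl x≗y)) (P? ∘ (true ∷ᵛ_))
... | inj₂ (x , ¬p) | _ = inj₂ (false ∷ᵛ x , ¬p)
... | inj₁ _ | inj₂ (x , ¬p) = inj₂ (true ∷ᵛ x , ¬p)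
... | inj₁ P-false | inj₁ P-true = inj₁ λ x → resp (∷-cong refl (λ _ → refl)) (by-head (head x) (tail x))
  where
  by-head : ∀ b x → P (b ∷ᵛ x)
  by-head false = P-false
  by-head true = P-true

module _ {n : ℕ} where

  improves-monotone-or-signDepends : ∀ (C : SimpleInstance n) i j →
    (∀ x → Improves C i x → Improves C i (flip j x)) ⊎ SignDepends (FitEdge C) i j
  improves-monotone-or-signDepends C i j
    with all-or-counterexample n (λ x → Improves C i x → Improves C i (flip j x))
           (λ x≗y monotone gain →
              improves-cong C i (flip-cong j x≗y) (monotone (improves-cong C i (sym ∘ x≗y) gain)))
           (λ x → (eval C x <? eval C (flip i x)) →-dec (eval C (flip j x) <? eval C (flip i (flip j x))))
  ... | inj₁ monotone = inj₁ monotone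
  ... | inj₂ (x , ¬monotone) with eval C x <? eval C (flip i x)
  ...   | yes gain = inj₂ (x , (flip-differInOne i x , gain) , λ edge → ¬monotone λ _ → proj₂ edge)
  ...   | no ¬gain = ⊥-elim (¬monotone (⊥-elim ∘ ¬gain))

  signEquivalent-refl : ∀ (C : SimpleInstance n) → SignEquivalent C C
  signEquivalent-refl C x y = id , id

  signEquivalent-sym : ∀ (A B : SimpleInstance n) → SignEquivalent A B → SignEquivalent B A
  signEquivalent-sym A B A~B x y = proj₂ (A~B x y) , proj₁ (A~B x y)

  signEquivalent-trans : ∀ (A B C : SimpleInstance n) →
    SignEquivalent A B → SignEquivalent B C → SignEquivalent A C
  signEquivalent-trans A B C A~B B~C x y =
    (proj₁ (B~C x y) ∘ proj₁ (A~B x y)) , (proj₂ (A~B x y) ∘ proj₂ (B~C x y))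

  signDepends-transfer : ∀ (A B : SimpleInstance n) → SignEquivalent A B →
    ∀ {i j} → SignDepends (FitEdge A) i j → SignDepends (FitEdge B) i j
  signDepends-transfer A B A~B {i} {j} (x , edge , ¬edge) =
    x , proj₁ (A~B x (flip i x)) edge , ¬edge ∘ proj₂ (A~B (flip j x) (flip i (flip j x)))

  signInteract-transfer : ∀ (A B : SimpleInstance n) → SignEquivalent A B →
    ∀ {i j} → SignInteract (FitEdge A) i j → SignInteract (FitEdge B) i j
  signInteract-transfer A B A~B (inj₁ dep) = inj₁ (signDepends-transfer A B A~B dep)
  signInteract-transfer A B A~B (inj₂ dep) = inj₂ (signDepends-transfer A B A~B dep)

  _⊆ᴱ_ : SimpleInstance n → SimpleInstance n → Set
  D ⊆ᴱ C = ∀ {i j} → InConstraintGraph D i j → InConstraintGraph C i j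

  erase-⊆ᴱ : ∀ C a b → erase C a b ⊆ᴱ C
  erase-⊆ᴱ C a b {i} {j} (i<j , c≢0) with erase-binary C a b i j
  ... | inj₁ (refl , refl) = ⊥-elim (c≢0 (erase-erases C a b))
  ... | inj₂ same = i<j , c≢0 ∘ trans same

  TrimAt : SimpleInstance n → Fin n → Fin n → Set
  TrimAt D i j = InConstraintGraph D i j → SignInteract (FitEdge D) i j

  trimAt-transfer : ∀ (D C : SimpleInstance n) → SignEquivalent D C → D ⊆ᴱ C →
    ∀ {i j} → TrimAt C i j → TrimAt D i j
  trimAt-transfer D C D~C D⊆C trim edge = signInteract-transfer C D (signEquivalent-sym D C D~C) (trim (D⊆C edge))

  Trimming : SimpleInstance n → (SimpleInstance n → Set) → Set
  Trimming C P = Σ[ D ∈ SimpleInstance n ] SignEquivalent D C × D ⊆ᴱ C × P D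

  trim-pair : ∀ C a b → Trimming C λ D → TrimAt D a b
  trim-pair C a b with toℕ a ℕ.<? toℕ b
  ... | no a≮b = C , signEquivalent-refl C , id , ⊥-elim ∘ a≮b ∘ proj₁
  ... | yes a<b with improves-monotone-or-signDepends C a b | improves-monotone-or-signDepends C b a
  ...   | inj₂ a-depends | _ = C , signEquivalent-refl C , id , λ _ → inj₁ a-depends
  ...   | inj₁ _ | inj₂ b-depends = C , signEquivalent-refl C , id , λ _ → inj₂ b-depends
  ...   | inj₁ a-monotone | inj₁ b-monotone =
    erase C a b , erase-signEquivalent C a<b a-monotone b-monotone , erase-⊆ᴱ C a b ,
    λ (_ , c≢0) → ⊥-elim (c≢0 (erase-erases C a b))

  trim-pairs : ∀ (ps : List (Fin n × Fin n)) C → Trimming C λ D → All (uncurry (TrimAt D)) ps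
  trim-pairs [] C = C , signEquivalent-refl C , id , []
  trim-pairs ((a , b) ∷ ps) C with trim-pair C a b
  ... | C₁ , C₁~C , C₁⊆C , trim₁ with trim-pairs ps C₁
  ... | D , D~C₁ , D⊆C₁ , trims =
    D , signEquivalent-trans D C₁ C D~C₁ C₁~C , C₁⊆C ∘ D⊆C₁ ,
    trimAt-transfer D C₁ D~C₁ D⊆C₁ trim₁ ∷ trims

theorem3 : (n : ℕ) (C′ : SimpleInstance n) →
    Σ (SimpleInstance n) λ C → Trim C × SignEquivalent C C′
theorem3 n C′ with trim-pairs (cartesianProduct (allFin n) (allFin n)) C′
... | C , C~C′ , _ , trims =
  C , (λ i j → All.lookup trims (∈-cartesianProduct⁺ (∈-allFin i) (∈-allFin j))) , C~C′
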